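{- Let $q$ be an odd prime power, let $\sigma$ be a permutation of $\mathbb{F}_q$ whose graph $\Gamma$ contains exactly $(q-1)/2$ collinear triples, and let $\Omega=\{[x:\sigma(x):1]:x\in\mathbb{F}_q\}\cup\{[1:0:0],[0:1:0]\}\subseteq PG(2,q)$. Write $\Omega=C\cup\{P\}$ with $C$ the point set of an irreducible conic and $P\notin C$ the external point. Then $P$ does not lie on the line at infinity $z=0$ (so $P\neq[1:0:0],[0:1:0]$), and consequently $\Gamma=\{(x,y): cxy+dx+ey+f=0\}\cup\{(x',y')\}$ for some $c,d,e,f\in\mathbb{F}_q$, where $P=[x':y':1]$.
   Context: A collinear triple in a permutation $\sigma$ of $\mathbb{F}_q$ is a set of three distinct points of its graph lying on a common line of the affine plane $\mathbb{F}_q^2$. It is known (and assumed here) that such an $\Omega$ is the union of the points of an irreducible conic and one external point not on it. -}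

module Defs where

open import Data.Nat using (ℕ; zero; suc)
open import Data.Product using (Σ; ∃; _×_; _,_)
open import Data.Sum using (_⊎_)
open import Data.List using (List; []; _∷_; map; _++_; length)
open import Data.List.Membership.Propositional using (_∈_)
open import Data.List.Relation.Unary.Unique.Propositional using (Unique)
open import Relation.Binary.PropositionalEquality using (_≡_; _≢_)
open import Relation.Binary.Definitions using (DecidableEquality)
open import Relation.Nullary using (¬_)
open import Algebra.Structures using (IsCommutativeRing)
open import Function.Bundles using (_⤖_; _⇔_)

record FiniteField : Set₁ where
  infixl 6 _+_
  infixl 7 _*_
  field
    F      : Set
    _+_    : F → F → F
    _*_    : F → F → F
    -_     : F → F
    0#     : F
    1#     : F
    isCommutativeRing : IsCommutativeRing _≡_ _+_ _*_ -_ 0# 1#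
    0≢1    : 0# ≢ 1#
    inverse : ∀ x → x ≢ 0# → Σ F (λ y → x * y ≡ 1#)
    _≟_    : DecidableEquality F
    elems  : List F
    elems-unique   : Unique elems
    elems-complete : ∀ x → x ∈ elems

  order : ℕ
  order = length elems

data Count {A : Set} (P : A → Set) : List A → ℕ → Set where
  c[]  : Count P [] 0
  cyes : ∀ {x xs n} → P x → Count P xs n → Count P (x ∷ xs) (suc n)
  cno  : ∀ {x xs n} → ¬ P x → Count P xs n → Count P (x ∷ xs) n

-- All 2- and 3-element sublists (as tuples, in list order).  For a
-- duplicate-free list these enumerate each 2-/3-subset exactly once.
pairs : {A : Set} → List A → List (A × A)
pairs []       = []
pairs (x ∷ xs) = map (λ y → (x , y)) xs ++ pairs xs

choose3 : {A : Set} → List A → List (A × A × A)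
choose3 []       = []
choose3 (x ∷ xs) = map (λ p → (x , p)) (pairs xs) ++ choose3 xs

module FieldGeometry (K : FiniteField) where
  open FiniteField K

  Pt : Set
  Pt = F × F

  Collinear : Pt → Pt → Pt → Set
  Collinear (x₁ , y₁) (x₂ , y₂) (x₃ , y₃) =
    ∃ λ a → ∃ λ b → ∃ λ c → ¬ (a ≡ 0# × b ≡ 0#) ×
      (a * x₁ + b * y₁ + c ≡ 0#) × (a * x₂ + b * y₂ + c ≡ 0#) × (a * x₃ + b * y₃ + c ≡ 0#)

  -- A 3-subset {x₁,x₂,x₃} of F_q gives a collinear triple of the graph of σ
  -- iff the three graph points are collinear (they are distinct since the
  -- x's are distinct).
  CollinearTriple : (F → F) → F × F × F → Set
  CollinearTriple σ (x₁ , x₂ , x₃) = Collinear (x₁ , σ x₁) (x₂ , σ x₂) (x₃ , σ x₃)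

  V3 : Set
  V3 = F × F × F

  NonZeroV : V3 → Set
  NonZeroV (x , y , z) = ¬ (x ≡ 0# × y ≡ 0# × z ≡ 0#)

  scale : F → V3 → V3
  scale l (x , y , z) = (l * x , l * y , l * z)

  _∼_ : V3 → V3 → Set
  v ∼ w = ∃ λ l → l ≢ 0# × v ≡ scale l w

  InΩ : (F → F) → V3 → Set
  InΩ σ v = (∃ λ x → v ∼ (x , σ x , 1#)) ⊎ (v ∼ (1# , 0# , 0#)) ⊎ (v ∼ (0# , 1# , 0#))

  record QForm : Set where
    constructor qform
    field a b c h g f : F

  evalQ : QForm → V3 → F
  evalQ (qform a b c h g f) (X , Y , Z) =
    a * X * X + b * Y * Y + c * Z * Z + h * X * Y + g * X * Z + f * Y * Z

  linProd : V3 → V3 → QForm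
  linProd (l₁ , l₂ , l₃) (m₁ , m₂ , m₃) =
    qform (l₁ * m₁) (l₂ * m₂) (l₃ * m₃)
          (l₁ * m₂ + l₂ * m₁) (l₁ * m₃ + l₃ * m₁) (l₂ * m₃ + l₃ * m₂)

  -- irreducible conic: the quadratic form is not a product of two linear
  -- forms (this also excludes the zero form)
  Irreducible : QForm → Set
  Irreducible Q = ¬ (∃ λ l → ∃ λ m → Q ≡ linProd l m)

module Submission where

-- If P lay on the line at infinity, every affine point (x, σ x) of the graph would lie on the
-- conic C. Since q = 2k + 1 > 1 there is a collinear triple in the graph, and a conic through three
-- points of a line Y = mX + n contains that line (its restriction is a quadratic with three roots),
-- so C would be reducible. Hence P is affine; then both points at infinity of Ω lie on C, which
-- kills the X² and Y² coefficients, and dehomogenising leaves cXY + dX + eY + f = 0 plus P.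

open import Level using (0ℓ)
open import Data.Nat using (ℕ; zero; suc)
import Data.Nat as N
open import Data.Nat.Properties using (+-suc)
open import Data.Integer as ℤ using (ℤ; +_; -[1+_]; _⊖_; sign; ∣_∣; _◃_; 0ℤ; 1ℤ)
import Data.Integer.Properties as ℤ
open import Data.Sign as Sign using (Sign)
open import Data.Maybe using (Maybe; just; nothing)
open import Data.Product using (∃; _×_; _,_; proj₁; proj₂)
open import Data.Product.Properties using (,-injectiveˡ; ,-injectiveʳ)
open import Data.Sum using (_⊎_; inj₁; inj₂)
open import Data.Sum.Function.Propositional using (_⊎-⇔_)
open import Data.Empty using (⊥-elim)
open import Data.List using ([]; _∷_; map; length)
open import Data.List.Membership.Propositional using (_∈_)
open import Data.List.Membership.Propositional.Properties using (∈-++⁻; ∈-map⁻)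
open import Data.List.Relation.Unary.Any using (here; there)
import Data.List.Relation.Unary.All as All
open import Data.List.Relation.Unary.AllPairs using (_∷_)
open import Data.List.Relation.Unary.Unique.Propositional using (Unique)
open import Function.Base using (_∘_)
open import Function.Bundles using (_⤖_; _⇔_; Bijection; Equivalence; mk⇔)
open import Function.Construct.Composition using (_⇔-∘_)
open import Function.Construct.Symmetry using (⇔-sym)
open import Relation.Nullary using (yes; no; ¬_)
open import Relation.Binary.PropositionalEquality as ≡
  using (_≡_; _≢_; refl; cong; cong₂; module ≡-Reasoning)
open import Algebra.Bundles using (CommutativeRing)
open import Algebra.Solver.Ring.AlmostCommutativeRing
  using (fromCommutativeRing; _-Raw-AlmostCommutative⟶_)

open import Defs

module IntegerCoefficients {c ℓ} (R : CommutativeRing c ℓ) where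
  open CommutativeRing R renaming (refl to ≈-refl; sym to ≈-sym; trans to ≈-trans)
  open import Algebra.Properties.Ring ring using (-1*x≈-x)
  open import Algebra.Properties.AbelianGroup +-abelianGroup using (⁻¹-∙-comm)
  open import Algebra.Properties.Group +-group using (ε⁻¹≈ε; ⁻¹-involutive)
  open import Algebra.Properties.CommutativeSemigroup +-commutativeSemigroup
    using () renaming (interchange to +-interchange)
  open import Algebra.Properties.CommutativeSemigroup *-commutativeSemigroup
    using () renaming (interchange to *-interchange)
  open import Algebra.Properties.Semiring.Mult.TCOptimised semiring using (1+×; ×-homo-+; ×1-homo-*)
    renaming (_×_ to _×′_)
  open import Relation.Binary.Reasoning.Setoid setoid

  -- With the tail-call-optimised multiple _×′_, fromℤ 0ℤ and fromℤ 1ℤ are definitionally 0# and 1#,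
  -- so con 0ℤ and con 1ℤ denote them in solver equations checked by refl.
  fromℤ : ℤ → Carrier
  fromℤ (+ n)    = n ×′ 1#
  fromℤ -[1+ n ] = - (suc n ×′ 1#)

  fromSign : Sign → Carrier
  fromSign Sign.+ = 1#
  fromSign Sign.- = - 1#

  fromℤ-⊖ : ∀ m n → fromℤ (m ⊖ n) ≈ m ×′ 1# - n ×′ 1#
  fromℤ-⊖ 0 0 = ≈-sym (-‿inverseʳ 0#)
  fromℤ-⊖ (suc m) 0 = begin
    suc m ×′ 1#       ≈⟨ +-identityʳ _ ⟨
    suc m ×′ 1# + 0#  ≈⟨ +-congˡ ε⁻¹≈ε ⟨
    suc m ×′ 1# - 0#  ∎
  fromℤ-⊖ 0 (suc n) = ≈-sym (+-identityˡ _)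
  fromℤ-⊖ (suc m) (suc n) = begin
    fromℤ (suc m ⊖ suc n)              ≡⟨ ≡.cong fromℤ (ℤ.[1+m]⊖[1+n]≡m⊖n m n) ⟩
    fromℤ (m ⊖ n)                      ≈⟨ fromℤ-⊖ m n ⟩
    m ×′ 1# - n ×′ 1#                  ≈⟨ +-identityˡ _ ⟨
    0# + (m ×′ 1# - n ×′ 1#)           ≈⟨ +-congʳ (-‿inverseʳ 1#) ⟨
    (1# - 1#) + (m ×′ 1# - n ×′ 1#)    ≈⟨ +-interchange 1# (- 1#) (m ×′ 1#) (- (n ×′ 1#)) ⟩
    (1# + m ×′ 1#) + (- 1# - n ×′ 1#)  ≈⟨ +-congˡ (⁻¹-∙-comm 1# (n ×′ 1#)) ⟩
    (1# + m ×′ 1#) - (1# + n ×′ 1#)    ≈⟨ +-cong (1+× m 1#) (-‿cong (1+× n 1#)) ⟨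
    suc m ×′ 1# - suc n ×′ 1#          ∎

  fromℤ-+ : ∀ i j → fromℤ (i ℤ.+ j) ≈ fromℤ i + fromℤ j
  fromℤ-+ (+ m)    (+ n)    = ×-homo-+ 1# m n
  fromℤ-+ (+ m)    -[1+ n ] = fromℤ-⊖ m (suc n)
  fromℤ-+ -[1+ m ] (+ n)    = ≈-trans (fromℤ-⊖ n (suc m)) (+-comm _ _)
  fromℤ-+ -[1+ m ] -[1+ n ] = begin
    - (suc (suc (m N.+ n)) ×′ 1#)  ≡⟨ ≡.cong (λ k → - (suc k ×′ 1#)) (+-suc m n) ⟨
    - ((suc m N.+ suc n) ×′ 1#)    ≈⟨ -‿cong (×-homo-+ 1# (suc m) (suc n)) ⟩
    - (suc m ×′ 1# + suc n ×′ 1#)  ≈⟨ ⁻¹-∙-comm _ _ ⟨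
    - (suc m ×′ 1#) - suc n ×′ 1#  ∎

  fromℤ-◃ : ∀ s n → fromℤ (s ◃ n) ≈ fromSign s * n ×′ 1#
  fromℤ-◃ s       0       = ≈-sym (zeroʳ (fromSign s))
  fromℤ-◃ Sign.+  (suc n) = ≈-sym (*-identityˡ _)
  fromℤ-◃ Sign.-  (suc n) = ≈-sym (-1*x≈-x _)

  fromSign-* : ∀ s t → fromSign (s Sign.* t) ≈ fromSign s * fromSign t
  fromSign-* Sign.+ t      = ≈-sym (*-identityˡ _)
  fromSign-* Sign.- Sign.+ = ≈-sym (*-identityʳ _)
  fromSign-* Sign.- Sign.- = ≈-sym (≈-trans (-1*x≈-x (- 1#)) (⁻¹-involutive 1#))

  fromℤ-sign-abs : ∀ i → fromℤ i ≈ fromSign (sign i) * ∣ i ∣ ×′ 1#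
  fromℤ-sign-abs i = ≈-trans (reflexive (≡.cong fromℤ (≡.sym (ℤ.◃-inverse i)))) (fromℤ-◃ (sign i) ∣ i ∣)

  fromℤ-* : ∀ i j → fromℤ (i ℤ.* j) ≈ fromℤ i * fromℤ j
  fromℤ-* i j = begin
    fromℤ (i ℤ.* j)
      ≈⟨ fromℤ-◃ (sign i Sign.* sign j) (∣ i ∣ N.* ∣ j ∣) ⟩
    fromSign (sign i Sign.* sign j) * (∣ i ∣ N.* ∣ j ∣) ×′ 1#
      ≈⟨ *-cong (fromSign-* (sign i) (sign j)) (×1-homo-* ∣ i ∣ ∣ j ∣) ⟩
    (fromSign (sign i) * fromSign (sign j)) * (∣ i ∣ ×′ 1# * ∣ j ∣ ×′ 1#)
      ≈⟨ *-interchange _ _ _ _ ⟩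
    (fromSign (sign i) * ∣ i ∣ ×′ 1#) * (fromSign (sign j) * ∣ j ∣ ×′ 1#)
      ≈⟨ *-cong (fromℤ-sign-abs i) (fromℤ-sign-abs j) ⟨
    fromℤ i * fromℤ j ∎

  fromℤ-neg : ∀ i → fromℤ (ℤ.- i) ≈ - fromℤ i
  fromℤ-neg (+ 0)     = ≈-sym ε⁻¹≈ε
  fromℤ-neg (+ suc n) = ≈-refl
  fromℤ-neg -[1+ n ]  = ≈-sym (⁻¹-involutive _)

  fromℤ-homomorphism : ℤ.+-*-rawRing -Raw-AlmostCommutative⟶ fromCommutativeRing R
  fromℤ-homomorphism = record
    { ⟦_⟧    = fromℤ
    ; +-homo = fromℤ-+
    ; *-homo = fromℤ-*
    ; -‿homo = fromℤ-neg
    ; 0-homo = ≈-refl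
    ; 1-homo = ≈-refl
    }

  fromℤ-≟ : ∀ i j → Maybe (fromℤ i ≈ fromℤ j)
  fromℤ-≟ i j with i ℤ.≟ j
  ... | yes ≡.refl = just ≈-refl
  ... | no  _      = nothing

  open import Algebra.Solver.Ring ℤ.+-*-rawRing (fromCommutativeRing R) fromℤ-homomorphism fromℤ-≟ public

module _ {A : Set} where

  Count-suc⇒∃ : ∀ {P : A → Set} {xs n} → Count P xs (suc n) → ∃ λ x → x ∈ xs × P x
  Count-suc⇒∃ (cyes p _) = _ , here refl , p
  Count-suc⇒∃ (cno _ c) with Count-suc⇒∃ c
  ... | x , x∈ , p = x , there x∈ , p

  ∈-pairs⁻ : ∀ {xs} {y z : A} → Unique xs → (y , z) ∈ pairs xs → y ∈ xs × z ∈ xs × y ≢ z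
  ∈-pairs⁻ {x ∷ xs} (x∉xs ∷ unique) yz∈ with ∈-++⁻ (map (λ y → x , y) xs) yz∈
  ... | inj₂ yz∈′ with ∈-pairs⁻ unique yz∈′
  ...   | y∈ , z∈ , y≢z = there y∈ , there z∈ , y≢z
  ∈-pairs⁻ {x ∷ xs} (x∉xs ∷ _) _ | inj₁ yz∈′ with ∈-map⁻ (λ y → x , y) yz∈′
  ...   | z , z∈ , refl = here refl , there z∈ , All.lookup x∉xs z∈

  ∈-choose3⇒distinct : ∀ {xs} {a b c : A} → Unique xs → (a , b , c) ∈ choose3 xs → a ≢ b × a ≢ c × b ≢ c
  ∈-choose3⇒distinct {x ∷ xs} (x∉xs ∷ unique) abc∈ with ∈-++⁻ (map (λ p → x , p) (pairs xs)) abc∈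
  ... | inj₂ abc∈′ = ∈-choose3⇒distinct unique abc∈′
  ... | inj₁ abc∈′ with ∈-map⁻ (λ p → x , p) abc∈′
  ...   | _ , bc∈ , refl with ∈-pairs⁻ unique bc∈
  ...     | b∈ , c∈ , b≢c = All.lookup x∉xs b∈ , All.lookup x∉xs c∈ , b≢c

  length≡1⇒∈-≡ : ∀ {xs} {a b : A} → length xs ≡ 1 → a ∈ xs → b ∈ xs → a ≡ b
  length≡1⇒∈-≡ {_ ∷ []} _ (here refl) (here refl) = refl
  length≡1⇒∈-≡ {_ ∷ []} _ (there ())
  length≡1⇒∈-≡ {_ ∷ []} _ (here _) (there ())

module FieldArithmetic (K : FiniteField) where
  open FiniteField K

  commutativeRing : CommutativeRing 0ℓ 0ℓ
  commutativeRing = record { isCommutativeRing = isCommutativeRing }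

  open CommutativeRing commutativeRing public
    using (_-_; -‿inverseʳ; +-identityˡ; *-identityˡ; *-identityʳ; *-assoc; *-comm; zeroʳ)
  open IntegerCoefficients commutativeRing public using (solve; _:=_; _:+_; _:-_; _:*_; :-_; con)
  open import Algebra.Properties.Group (CommutativeRing.+-group commutativeRing) using (x∙y⁻¹≈ε⇒x≈y)
  open ≡-Reasoning

  1≢0 : 1# ≢ 0#
  1≢0 = 0≢1 ∘ ≡.sym

  x≢0⇒x*y≡0⇒y≡0 : ∀ {x y} → x ≢ 0# → x * y ≡ 0# → y ≡ 0#
  x≢0⇒x*y≡0⇒y≡0 {x} {y} x≢0 xy≡0 with inverse x x≢0
  ... | x⁻¹ , xx⁻¹≡1 = begin
    y               ≡⟨ *-identityˡ y ⟨
    1# * y          ≡⟨ cong (_* y) xx⁻¹≡1 ⟨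
    (x * x⁻¹) * y   ≡⟨ solve 3 (λ x x⁻¹ y → (x :* x⁻¹) :* y := x⁻¹ :* (x :* y)) refl x x⁻¹ y ⟩
    x⁻¹ * (x * y)   ≡⟨ cong (x⁻¹ *_) xy≡0 ⟩
    x⁻¹ * 0#        ≡⟨ zeroʳ x⁻¹ ⟩
    0#              ∎

  x≢0∧y≢0⇒x*y≢0 : ∀ {x y} → x ≢ 0# → y ≢ 0# → x * y ≢ 0#
  x≢0∧y≢0⇒x*y≢0 x≢0 y≢0 = y≢0 ∘ x≢0⇒x*y≡0⇒y≡0 x≢0

  x≢y⇒[x-y]*w≡0⇒w≡0 : ∀ {x y w} → x ≢ y → (x - y) * w ≡ 0# → w ≡ 0#
  x≢y⇒[x-y]*w≡0⇒w≡0 {x} {y} x≢y = x≢0⇒x*y≡0⇒y≡0 (x≢y ∘ x∙y⁻¹≈ε⇒x≈y x y)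

  drop-zero-summand : ∀ {x y z} → x ≡ z + y → z ≡ 0# → x ≡ y
  drop-zero-summand {y = y} x≡z+y refl = ≡.trans x≡z+y (+-identityˡ y)

  linear-two-roots : ∀ B C {x y} → x ≢ y → B * x + C ≡ 0# → B * y + C ≡ 0# → B ≡ 0# × C ≡ 0#
  linear-two-roots B C {x} {y} x≢y Bx+C≡0 By+C≡0 = B≡0 , C≡0
    where
    B≡0 : B ≡ 0#
    B≡0 = x≢y⇒[x-y]*w≡0⇒w≡0 x≢y (begin
      (x - y) * B                ≡⟨ solve 4 (λ B C x y → (x :- y) :* B := (B :* x :+ C) :- (B :* y :+ C)) refl B C x y ⟩
      (B * x + C) - (B * y + C)  ≡⟨ cong₂ _-_ Bx+C≡0 By+C≡0 ⟩
      0# - 0#                    ≡⟨ -‿inverseʳ 0# ⟩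
      0#                         ∎)
    C≡0 : C ≡ 0#
    C≡0 = begin
      C                    ≡⟨ solve 3 (λ B C x → C := (B :* x :+ C) :- B :* x) refl B C x ⟩
      (B * x + C) - B * x  ≡⟨ cong₂ (λ s t → s - t * x) Bx+C≡0 B≡0 ⟩
      0# - 0# * x          ≡⟨ solve 1 (λ x → con 0ℤ :- con 0ℤ :* x := con 0ℤ) refl x ⟩
      0#                   ∎

  -- Dividing A X² + B X + C by X - x leaves A X + (A x + B).
  quadratic-quotient-root : ∀ A B C {x y} → x ≢ y →
    A * x * x + B * x + C ≡ 0# → A * y * y + B * y + C ≡ 0# → A * y + (A * x + B) ≡ 0#
  quadratic-quotient-root A B C {x} {y} x≢y px≡0 py≡0 = x≢y⇒[x-y]*w≡0⇒w≡0 x≢y (begin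
    (x - y) * (A * y + (A * x + B))
      ≡⟨ solve 5 (λ A B C x y → (x :- y) :* (A :* y :+ (A :* x :+ B))
                               := (A :* x :* x :+ B :* x :+ C) :- (A :* y :* y :+ B :* y :+ C)) refl A B C x y ⟩
    (A * x * x + B * x + C) - (A * y * y + B * y + C)  ≡⟨ cong₂ _-_ px≡0 py≡0 ⟩
    0# - 0#                                            ≡⟨ -‿inverseʳ 0# ⟩
    0#                                                 ∎)

  quadratic-three-roots : ∀ A B C {x₁ x₂ x₃} → x₁ ≢ x₂ → x₁ ≢ x₃ → x₂ ≢ x₃ →
    A * x₁ * x₁ + B * x₁ + C ≡ 0# → A * x₂ * x₂ + B * x₂ + C ≡ 0# → A * x₃ * x₃ + B * x₃ + C ≡ 0# →
    A ≡ 0# × B ≡ 0# × C ≡ 0#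
  quadratic-three-roots A B C {x₁} x₁≢x₂ x₁≢x₃ x₂≢x₃ p₁ p₂ p₃ =
    A≡0 , linear-two-roots B C x₁≢x₂ (linear p₁) (linear p₂)
    where
    A≡0 : A ≡ 0#
    A≡0 = proj₁ (linear-two-roots A (A * x₁ + B) x₂≢x₃
                   (quadratic-quotient-root A B C x₁≢x₂ p₁ p₂) (quadratic-quotient-root A B C x₁≢x₃ p₁ p₃))
    linear : ∀ {x} → A * x * x + B * x + C ≡ 0# → B * x + C ≡ 0#
    linear {x} px≡0 = begin
      B * x + C                            ≡⟨ solve 4 (λ A B C x →
                                                B :* x :+ C := (A :* x :* x :+ B :* x :+ C) :- A :* x :* x) refl A B C x ⟩
      (A * x * x + B * x + C) - A * x * x  ≡⟨ cong₂ (λ s t → s - t * x * x) px≡0 A≡0 ⟩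
      0# - 0# * x * x                      ≡⟨ solve 1 (λ x → con 0ℤ :- con 0ℤ :* x :* x := con 0ℤ) refl x ⟩
      0#                                   ∎

module PlaneGeometry (K : FiniteField) where
  open FiniteField K
  open FieldGeometry K
  open FieldArithmetic K
  open ≡-Reasoning

  scale-1# : ∀ v → scale 1# v ≡ v
  scale-1# (x , y , z) = cong₂ _,_ (*-identityˡ x) (cong₂ _,_ (*-identityˡ y) (*-identityˡ z))

  scale-* : ∀ l m v → scale l (scale m v) ≡ scale (l * m) v
  scale-* l m (x , y , z) = ≡.sym (cong₂ _,_ (*-assoc l m x) (cong₂ _,_ (*-assoc l m y) (*-assoc l m z)))

  ∼-refl : ∀ {v} → v ∼ v
  ∼-refl {v} = 1# , 1≢0 , ≡.sym (scale-1# v)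

  ∼-trans : ∀ {u v w} → u ∼ v → v ∼ w → u ∼ w
  ∼-trans (l , l≢0 , refl) (m , m≢0 , refl) = l * m , x≢0∧y≢0⇒x*y≢0 l≢0 m≢0 , scale-* l m _

  affine-nonzero : ∀ x y → NonZeroV (x , y , 1#)
  affine-nonzero x y (_ , _ , 1≡0) = 1≢0 1≡0

  affine-∼⇒≡ : ∀ {x y x′ y′} → (x , y , 1#) ∼ (x′ , y′ , 1#) → x ≡ x′ × y ≡ y′
  affine-∼⇒≡ {x} {y} {x′} {y′} (l , _ , eq) =
    coordinate x x′ (,-injectiveˡ eq) , coordinate y y′ (,-injectiveˡ (,-injectiveʳ eq))
    where
    l≡1 : l ≡ 1#
    l≡1 = ≡.trans (≡.sym (*-identityʳ l)) (≡.sym (,-injectiveʳ (,-injectiveʳ eq)))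
    coordinate : ∀ a a′ → a ≡ l * a′ → a ≡ a′
    coordinate a a′ a≡la′ = ≡.trans a≡la′ (≡.trans (cong (_* a′) l≡1) (*-identityˡ a′))

  ∼-infinite⇒z≡0 : ∀ {x y z a b} → (x , y , z) ∼ (a , b , 0#) → z ≡ 0#
  ∼-infinite⇒z≡0 (l , _ , eq) = ≡.trans (,-injectiveʳ (,-injectiveʳ eq)) (zeroʳ l)

  infinite-∼⇒z≡0 : ∀ {x y z a b} → (a , b , 0#) ∼ (x , y , z) → z ≡ 0#
  infinite-∼⇒z≡0 (l , l≢0 , eq) = x≢0⇒x*y≡0⇒y≡0 l≢0 (≡.sym (,-injectiveʳ (,-injectiveʳ eq)))

  dehomogenise : ∀ {x y z} → z ≢ 0# →
    ∃ λ x′ → ∃ λ y′ → (x , y , z) ∼ (x′ , y′ , 1#) × (x′ , y′ , 1#) ∼ (x , y , z)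
  dehomogenise {x} {y} {z} z≢0 with inverse z z≢0
  ... | z⁻¹ , zz⁻¹≡1 = x * z⁻¹ , y * z⁻¹
                     , (z , z≢0 , cong₂ _,_ (undo x) (cong₂ _,_ (undo y) (≡.sym (*-identityʳ z))))
                     , (z⁻¹ , z⁻¹≢0 , cong₂ _,_ (*-comm x z⁻¹)
                                        (cong₂ _,_ (*-comm y z⁻¹) (≡.sym (≡.trans (*-comm z⁻¹ z) zz⁻¹≡1))))
    where
    z⁻¹≢0 : z⁻¹ ≢ 0#
    z⁻¹≢0 z⁻¹≡0 = 1≢0 (≡.trans (≡.sym zz⁻¹≡1) (≡.trans (cong (z *_) z⁻¹≡0) (zeroʳ z)))
    undo : ∀ a → a ≡ z * (a * z⁻¹)
    undo a = begin
      a              ≡⟨ *-identityʳ a ⟨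
      a * 1#         ≡⟨ cong (a *_) zz⁻¹≡1 ⟨
      a * (z * z⁻¹)  ≡⟨ solve 3 (λ a z z⁻¹ → a :* (z :* z⁻¹) := z :* (a :* z⁻¹)) refl a z z⁻¹ ⟩
      z * (a * z⁻¹)  ∎

  evalQ-[1:0:0] : ∀ Q → evalQ Q (1# , 0# , 0#) ≡ QForm.a Q
  evalQ-[1:0:0] (qform a b c h g f) =
    solve 6 (λ a b c h g f → a :* con 1ℤ :* con 1ℤ :+ b :* con 0ℤ :* con 0ℤ :+ c :* con 0ℤ :* con 0ℤ
                             :+ h :* con 1ℤ :* con 0ℤ :+ g :* con 1ℤ :* con 0ℤ :+ f :* con 0ℤ :* con 0ℤ := a)
      refl a b c h g f

  evalQ-[0:1:0] : ∀ Q → evalQ Q (0# , 1# , 0#) ≡ QForm.b Q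
  evalQ-[0:1:0] (qform a b c h g f) =
    solve 6 (λ a b c h g f → a :* con 0ℤ :* con 0ℤ :+ b :* con 1ℤ :* con 1ℤ :+ c :* con 0ℤ :* con 0ℤ
                             :+ h :* con 0ℤ :* con 1ℤ :+ g :* con 0ℤ :* con 0ℤ :+ f :* con 1ℤ :* con 0ℤ := b)
      refl a b c h g f

  evalQ-affine : ∀ Q → QForm.a Q ≡ 0# → QForm.b Q ≡ 0# → ∀ x y →
    evalQ Q (x , y , 1#) ≡ QForm.h Q * x * y + QForm.g Q * x + QForm.f Q * y + QForm.c Q
  evalQ-affine (qform _ _ c h g f) refl refl x y =
    solve 6 (λ c h g f x y → con 0ℤ :* x :* x :+ con 0ℤ :* y :* y :+ c :* con 1ℤ :* con 1ℤ
                             :+ h :* x :* y :+ g :* x :* con 1ℤ :+ f :* y :* con 1ℤ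
                             := h :* x :* y :+ g :* x :+ f :* y :+ c)
      refl c h g f x y

  qform-cong : ∀ {a b c h g f a′ b′ c′ h′ g′ f′} → a ≡ a′ → b ≡ b′ → c ≡ c′ → h ≡ h′ → g ≡ g′ → f ≡ f′ →
    qform a b c h g f ≡ qform a′ b′ c′ h′ g′ f′
  qform-cong refl refl refl refl refl refl = refl

  distinct-x⇒nonvertical : ∀ {α β γ x₁ y₁ x₂ y₂} → ¬ (α ≡ 0# × β ≡ 0#) → x₁ ≢ x₂ →
    α * x₁ + β * y₁ + γ ≡ 0# → α * x₂ + β * y₂ + γ ≡ 0# → β ≢ 0#
  distinct-x⇒nonvertical {α} {γ = γ} not-both-zero x₁≢x₂ l₁ l₂ refl =
    not-both-zero (proj₁ (linear-two-roots α γ x₁≢x₂ (vertical l₁) (vertical l₂)) , refl)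
    where
    vertical : ∀ {x y} → α * x + 0# * y + γ ≡ 0# → α * x + γ ≡ 0#
    vertical {x} {y} = ≡.trans (solve 4 (λ α γ x y → α :* x :+ γ := α :* x :+ con 0ℤ :* y :+ γ) refl α γ x y)

  nonvertical-line-is-graph : ∀ {α β γ} → β ≢ 0# →
    ∃ λ m → ∃ λ n → ∀ {x y} → α * x + β * y + γ ≡ 0# → y ≡ m * x + n
  nonvertical-line-is-graph {α} {β} {γ} β≢0 with inverse β β≢0
  ... | β⁻¹ , ββ⁻¹≡1 = m , n , λ {x} {y} on-line → begin
    y                                      ≡⟨ *-identityʳ y ⟨
    y * 1#                                 ≡⟨ cong (y *_) ββ⁻¹≡1 ⟨
    y * (β * β⁻¹)                          ≡⟨ solve 6 (λ α β γ β⁻¹ x y → y :* (β :* β⁻¹)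
                                                := :- (α :* β⁻¹) :* x :+ :- (γ :* β⁻¹) :+ (α :* x :+ β :* y :+ γ) :* β⁻¹)
                                                refl α β γ β⁻¹ x y ⟩
    m * x + n + (α * x + β * y + γ) * β⁻¹  ≡⟨ cong (λ t → m * x + n + t * β⁻¹) on-line ⟩
    m * x + n + 0# * β⁻¹                   ≡⟨ solve 3 (λ u v β⁻¹ → u :+ v :+ con 0ℤ :* β⁻¹ := u :+ v) refl (m * x) n β⁻¹ ⟩
    m * x + n                              ∎
    where
    m n : F
    m = - (α * β⁻¹)
    n = - (γ * β⁻¹)

  -- On the line Y = mX + nZ the form restricts to A X² + B XZ + C Z²; once these vanish,
  -- Q is (Y - mX - nZ)((h + bm) X + b Y + (f + bn) Z).
  conic-vanishing-on-line-factors : ∀ Q m n {x₁ x₂ x₃} → x₁ ≢ x₂ → x₁ ≢ x₃ → x₂ ≢ x₃ →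
    evalQ Q (x₁ , m * x₁ + n , 1#) ≡ 0# → evalQ Q (x₂ , m * x₂ + n , 1#) ≡ 0# →
    evalQ Q (x₃ , m * x₃ + n , 1#) ≡ 0# →
    ∃ λ l → ∃ λ l′ → Q ≡ linProd l l′
  conic-vanishing-on-line-factors Q@(qform a b c h g f) m n x₁≢x₂ x₁≢x₃ x₂≢x₃ e₁ e₂ e₃ =
    let A≡0 , B≡0 , C≡0 = quadratic-three-roots A B C x₁≢x₂ x₁≢x₃ x₂≢x₃
                            (restriction e₁) (restriction e₂) (restriction e₃) in
    (- m , 1# , - n) , (h + b * m , b , f + b * n) ,
    qform-cong (drop-zero-summand
                  (solve 5 (λ a b h m n → a := (a :+ b :* m :* m :+ h :* m) :+ :- m :* (h :+ b :* m)) refl a b h m n) A≡0)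
               (≡.sym (*-identityˡ b))
               (drop-zero-summand
                  (solve 4 (λ b c f n → c := (b :* n :* n :+ c :+ f :* n) :+ :- n :* (f :+ b :* n)) refl b c f n) C≡0)
               (solve 3 (λ b h m → h := :- m :* b :+ con 1ℤ :* (h :+ b :* m)) refl b h m)
               (drop-zero-summand
                  (solve 6 (λ b h g f m n → g := (b :* m :* n :+ b :* m :* n :+ h :* n :+ g :+ f :* m)
                                                 :+ (:- m :* (f :+ b :* n) :+ :- n :* (h :+ b :* m))) refl b h g f m n) B≡0)
               (solve 3 (λ b f n → f := con 1ℤ :* (f :+ b :* n) :+ :- n :* b) refl b f n)
    where
    A B C : F
    A = a + b * m * m + h * m
    B = b * m * n + b * m * n + h * n + g + f * m
    C = b * n * n + c + f * n
    restriction : ∀ {x} → evalQ Q (x , m * x + n , 1#) ≡ 0# → A * x * x + B * x + C ≡ 0#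
    restriction {x} = ≡.trans (solve 9 (λ a b c h g f m n x →
        (a :+ b :* m :* m :+ h :* m) :* x :* x :+ (b :* m :* n :+ b :* m :* n :+ h :* n :+ g :+ f :* m) :* x
          :+ (b :* n :* n :+ c :+ f :* n)
      := a :* x :* x :+ b :* (m :* x :+ n) :* (m :* x :+ n) :+ c :* con 1ℤ :* con 1ℤ :+ h :* x :* (m :* x :+ n)
          :+ g :* x :* con 1ℤ :+ f :* (m :* x :+ n) :* con 1ℤ) refl a b c h g f m n x)

  collinear-on-conic⇒factors : ∀ Q {x₁ y₁ x₂ y₂ x₃ y₃} → x₁ ≢ x₂ → x₁ ≢ x₃ → x₂ ≢ x₃ →
    Collinear (x₁ , y₁) (x₂ , y₂) (x₃ , y₃) →
    evalQ Q (x₁ , y₁ , 1#) ≡ 0# → evalQ Q (x₂ , y₂ , 1#) ≡ 0# → evalQ Q (x₃ , y₃ , 1#) ≡ 0# →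
    ∃ λ l → ∃ λ l′ → Q ≡ linProd l l′
  collinear-on-conic⇒factors Q x₁≢x₂ x₁≢x₃ x₂≢x₃ (α , β , γ , not-both-zero , l₁ , l₂ , l₃) e₁ e₂ e₃
    with nonvertical-line-is-graph (distinct-x⇒nonvertical not-both-zero x₁≢x₂ l₁ l₂)
  ... | m , n , on-graph
    with on-graph l₁ | on-graph l₂ | on-graph l₃
  ... | refl | refl | refl = conic-vanishing-on-line-factors Q m n x₁≢x₂ x₁≢x₃ x₂≢x₃ e₁ e₂ e₃

  module GraphOfPermutation (σ : F → F) (Q : QForm) (px py pz : F)
    (Ω≡C∪P : ∀ v → NonZeroV v → InΩ σ v ⇔ (evalQ Q v ≡ 0# ⊎ v ∼ (px , py , pz))) where

    P : V3
    P = px , py , pz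

    InΩ-affine : ∀ x y → InΩ σ (x , y , 1#) ⇔ (y ≡ σ x)
    InΩ-affine x y = mk⇔ to from
      where
      to : InΩ σ (x , y , 1#) → y ≡ σ x
      to (inj₁ (x₀ , v∼)) with affine-∼⇒≡ v∼
      ... | refl , y≡σx = y≡σx
      to (inj₂ (inj₁ v∼)) = ⊥-elim (1≢0 (∼-infinite⇒z≡0 v∼))
      to (inj₂ (inj₂ v∼)) = ⊥-elim (1≢0 (∼-infinite⇒z≡0 v∼))
      from : y ≡ σ x → InΩ σ (x , y , 1#)
      from refl = inj₁ (x , ∼-refl)

    graph-on-conic : pz ≡ 0# → ∀ x → evalQ Q (x , σ x , 1#) ≡ 0#
    graph-on-conic refl x
      with Equivalence.to (Ω≡C∪P _ (affine-nonzero x (σ x))) (Equivalence.from (InΩ-affine x (σ x)) refl)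
    ... | inj₁ on-conic = on-conic
    ... | inj₂ v∼P = ⊥-elim (1≢0 (∼-infinite⇒z≡0 v∼P))

    P-not-at-infinity : ∀ k → order ≡ suc (k N.+ k) → Count (CollinearTriple σ) (choose3 elems) k →
      Irreducible Q → pz ≢ 0#
    P-not-at-infinity zero q≡1 _ _ _ = 0≢1 (length≡1⇒∈-≡ q≡1 (elems-complete 0#) (elems-complete 1#))
    P-not-at-infinity (suc k) _ triples irreducible pz≡0
      with Count-suc⇒∃ triples
    ... | (x₁ , x₂ , x₃) , triple∈ , collinear
      with ∈-choose3⇒distinct elems-unique triple∈
    ... | x₁≢x₂ , x₁≢x₃ , x₂≢x₃ =
      irreducible (collinear-on-conic⇒factors Q x₁≢x₂ x₁≢x₃ x₂≢x₃ collinear (on x₁) (on x₂) (on x₃))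
      where
      on : ∀ x → evalQ Q (x , σ x , 1#) ≡ 0#
      on = graph-on-conic pz≡0

    infinite-point-on-conic : pz ≢ 0# → ∀ {a b} → NonZeroV (a , b , 0#) → InΩ σ (a , b , 0#) →
      evalQ Q (a , b , 0#) ≡ 0#
    infinite-point-on-conic pz≢0 nonzero ∈Ω with Equivalence.to (Ω≡C∪P _ nonzero) ∈Ω
    ... | inj₁ on-conic = on-conic
    ... | inj₂ v∼P = ⊥-elim (pz≢0 (infinite-∼⇒z≡0 v∼P))

    graph-equation : pz ≢ 0# → ∃ λ x′ → ∃ λ y′ → P ∼ (x′ , y′ , 1#) ×
      (∃ λ c → ∃ λ d → ∃ λ e → ∃ λ f →
        ∀ x y → (y ≡ σ x) ⇔ ((c * x * y + d * x + e * y + f ≡ 0#) ⊎ (x ≡ x′ × y ≡ y′)))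
    graph-equation pz≢0 with dehomogenise pz≢0
    ... | x′ , y′ , P∼P′ , P′∼P = x′ , y′ , P∼P′ , QForm.h Q , QForm.g Q , QForm.f Q , QForm.c Q , λ x y →
      (on-conic⇔ x y ⊎-⇔ on-P⇔ x y) ⇔-∘ (Ω≡C∪P _ (affine-nonzero x y) ⇔-∘ ⇔-sym (InΩ-affine x y))
      where
      a≡0 : QForm.a Q ≡ 0#
      a≡0 = ≡.trans (≡.sym (evalQ-[1:0:0] Q))
                    (infinite-point-on-conic pz≢0 (1≢0 ∘ proj₁) (inj₂ (inj₁ ∼-refl)))
      b≡0 : QForm.b Q ≡ 0#
      b≡0 = ≡.trans (≡.sym (evalQ-[0:1:0] Q))
                    (infinite-point-on-conic pz≢0 (1≢0 ∘ proj₁ ∘ proj₂) (inj₂ (inj₂ ∼-refl)))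
      on-conic⇔ : ∀ x y → (evalQ Q (x , y , 1#) ≡ 0#) ⇔
        (QForm.h Q * x * y + QForm.g Q * x + QForm.f Q * y + QForm.c Q ≡ 0#)
      on-conic⇔ x y =
        mk⇔ (≡.trans (≡.sym (evalQ-affine Q a≡0 b≡0 x y))) (≡.trans (evalQ-affine Q a≡0 b≡0 x y))
      on-P⇔ : ∀ x y → (x , y , 1#) ∼ P ⇔ (x ≡ x′ × y ≡ y′)
      on-P⇔ x y = mk⇔ (λ v∼P → affine-∼⇒≡ (∼-trans v∼P P∼P′)) λ { (refl , refl) → P′∼P }

mainTheorem6 : (K : FiniteField) → let open FiniteField K in let open FieldGeometry K in
    (k : ℕ) → order ≡ suc (k N.+ k) →
    (σ : F ⤖ F) →
    Count (CollinearTriple (Bijection.to σ)) (choose3 elems) k →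
    (Q : QForm) → Irreducible Q →
    (P : V3) → NonZeroV P → evalQ Q P ≢ 0# →
    (∀ v → NonZeroV v → (InΩ (Bijection.to σ) v ⇔ (evalQ Q v ≡ 0# ⊎ v ∼ P))) →
    (proj₂ (proj₂ P) ≢ 0#) ×
    (∃ λ x' → ∃ λ y' → P ∼ (x' , y' , 1#) ×
    (∃ λ c → ∃ λ d → ∃ λ e → ∃ λ f →
    ∀ x y → ((y ≡ Bijection.to σ x) ⇔
    ((c * x * y + d * x + e * y + f ≡ 0#) ⊎ (x ≡ x' × y ≡ y')))))
mainTheorem6 K k q≡2k+1 σ triples Q irreducible (px , py , pz) _ _ Ω≡C∪P = pz≢0 , graph-equation pz≢0
  where
  open FiniteField K using (0#)
  open PlaneGeometry K
  open GraphOfPermutation (Bijection.to σ) Q px py pz Ω≡C∪P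
  pz≢0 : pz ≢ 0#
  pz≢0 = P-not-at-infinity k q≡2k+1 triples irreducible
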